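{- Let $\Omega_\diamond$ be a finite list of modal rules (elements of $\{\lambda,\mathsf{J}\}$). For all modal trees $\mathtt{T},\mathtt{S}$: (1) if $\mathtt{T}\hookrightarrow^{\lambda}\circ\hookrightarrow^{\pi^+*}\mathtt{S}$, then $\mathtt{T}\hookrightarrow^{\pi^+*}\circ\hookrightarrow^{\lambda*}\mathtt{S}$, where the second derivation uses the same number of $\pi^+$-steps as the first; (2) if $\mathtt{T}\hookrightarrow^{\Omega_\diamond}\circ\hookrightarrow^{\pi^+*}\mathtt{S}$, then $\mathtt{T}\hookrightarrow^{\pi^+*}\circ\hookrightarrow^{\Omega'_\diamond}\circ\hookrightarrow^{\sigma*}\mathtt{S}$ for some finite list $\Omega'_\diamond$ of modal rules.
   Context: Modal trees: recursively, pairs $\langle\Delta;\Gamma\rangle$ with $\Delta$ a finite list of propositional variables and $\Gamma$ a finite list of pairs $(\alpha,\mathtt{S})$, $\alpha<\omega$, $\mathtt{S}$ a modal tree. Positions: $\mathrm{Pos}(\langle\Delta;\varnothing\rangle)=\{\epsilon\}$; $\mathrm{Pos}(\langle\Delta;[(\alpha_1,\mathtt{S}_1),\dots,(\alpha_n,\mathtt{S}_n)]\rangle)=\{\epsilon\}\cup\bigcup_{i=1}^n\{i\mathbf{k}\mid\mathbf{k}\in\mathrm{Pos}(\mathtt{S}_i)\}$. Subtree: $\mathtt{T}|_\epsilon=\mathtt{T}$, $\mathtt{T}|_{i\mathbf{r}}=\mathtt{S}_i|_{\mathbf{r}}$. Replacement: $\mathtt{T}[\mathtt{S}]_\epsilon=\mathtt{S}$,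 $\mathtt{T}[\mathtt{S}]_{i\mathbf{r}}$ is $\mathtt{T}$ with its $i$-th child $\mathtt{S}_i$ replaced by $\mathtt{S}_i[\mathtt{S}]_{\mathbf{r}}$ (same edge label). List operations, for $0<i,j\le|\Gamma|$: $\#_i\Gamma$ is the $i$-th element; $\Gamma^{ -i}$ deletes it; $\Gamma^{+i}=(\#_i\Gamma)\frown\Gamma$; $\Gamma[x]_i$ replaces the $i$-th element by $x$; $\Gamma^{i\leftrightarrow j}$ swaps the $i$-th and $j$-th elements. Rules (for a modal tree $\mathtt{T}$, $\mathbf{k}\in\mathrm{Pos}(\mathtt{T})$, $\mathtt{T}|_\mathbf{k}=\langle\Delta;\Gamma\rangle$): ($\sigma$) $\mathtt{T}\hookrightarrow^{\sigma}\mathtt{T}[\langle\Delta;\Gamma^{i\leftrightarrow j}\rangle]_\mathbf{k}$, $i\ne j$; ($\pi^+$) $\mathtt{T}\hookrightarrow^{\pi^+}\mathtt{T}[\langle\Delta;\Gamma^{+i}\rangle]_\mathbf{k}$; ($\lambda$) if $\#_i\Gamma=(\alpha,\mathtt{S})$ and $\alpha>\beta$, then $\mathtt{T}\hookrightarrow^{\lambda}\mathtt{T}[\langle\Delta;\Gamma[(\beta,\mathtt{S})]_i\rangle]_\mathbf{k}$; ($\mathsf{J}$) if $i\ne j$, $\#_i\Gamma=(\alpha,\langle\tilde\Delta;\tilde\Gamma\rangle)$, $\#_j\Gamma=(\beta,\mathtt{S})$, $\alpha>\beta$, then $\mathtt{T}\hookrightarrow^{\mathsf{J}}\mathtt{T}[\langle\Delta;(\Gamma[(\alpha,\langle\tilde\Delta;\tilde\Gamma\frown(\beta,\mathtt{S})\rangle)]_i)^{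 -j}\rangle]_\mathbf{k}$. Notation: for a list $\Omega$ of rules, $\mathtt{T}\hookrightarrow^{\Omega}\mathtt{S}$ means $\mathtt{S}=\mathtt{T}$ if $\Omega=\varnothing$, and $\mathtt{T}\hookrightarrow^{\mu}\mathtt{U}\hookrightarrow^{\hat\Omega}\mathtt{S}$ for some $\mathtt{U}$ if $\Omega=\mu\frown\hat\Omega$; $\mathtt{T}\hookrightarrow^{X}\circ\hookrightarrow^{Y}\mathtt{S}$ means there is $\mathtt{U}$ with $\mathtt{T}\hookrightarrow^{X}\mathtt{U}\hookrightarrow^{Y}\mathtt{S}$; $\hookrightarrow^{\mu*}$ means zero or more applications of rule $\mu$. -}

module Defs where

open import Data.Nat using (ℕ; zero; suc; _<_)
open import Data.List using (List; []; _∷_; _++_; [_]; replicate)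
open import Data.Maybe using (Maybe; just; nothing)
open import Data.Product using (_×_; _,_; Σ; ∃; ∃-syntax)
open import Relation.Binary.PropositionalEquality using (_≡_; _≢_)
open import Relation.Binary.Construct.Closure.ReflexiveTransitive using (Star)

Var : Set
Var = ℕ

-- Modal trees ⟨Δ;Γ⟩ : Δ a list of variables, Γ a list of (α , S).
data Tree : Set where
  node : List Var → List (ℕ × Tree) → Tree

-- List operations, 0-based indices (index i here = (i+1)-th element).

_‼_ : {A : Set} → List A → ℕ → Maybe A
[] ‼ _ = nothing
(x ∷ xs) ‼ zero = just x
(x ∷ xs) ‼ suc i = xs ‼ i

upd : {A : Set} → List A → ℕ → A → List A
upd [] _ _ = []
upd (y ∷ ys) zero x = x ∷ ys
upd (y ∷ ys) (suc i) x = y ∷ upd ys i x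

del : {A : Set} → List A → ℕ → List A
del [] _ = []
del (y ∷ ys) zero = ys
del (y ∷ ys) (suc i) = y ∷ del ys i

Position : Set
Position = List ℕ

mutual
  subtree : Tree → Position → Maybe Tree
  subtree T [] = just T
  subtree (node Δ Γ) (i ∷ r) = subtreeL Γ i r

  subtreeL : List (ℕ × Tree) → ℕ → Position → Maybe Tree
  subtreeL [] _ _ = nothing
  subtreeL ((α , S) ∷ Γ) zero r = subtree S r
  subtreeL (_ ∷ Γ) (suc i) r = subtreeL Γ i r

mutual
  replace : Tree → Position → Tree → Tree
  replace T [] S = S
  replace (node Δ Γ) (i ∷ r) S = node Δ (replaceL Γ i r S)

  replaceL : List (ℕ × Tree) → ℕ → Position → Tree → List (ℕ × Tree)
  replaceL [] _ _ _ = []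
  replaceL ((α , S') ∷ Γ) zero r S = (α , replace S' r S) ∷ Γ
  replaceL (x ∷ Γ) (suc i) r S = x ∷ replaceL Γ i r S

data Rule : Set where
  σ π⁺ lam J : Rule

data IsModal : Rule → Set where
  lam-modal : IsModal lam
  J-modal   : IsModal J

data Local : Rule → List Var → List (ℕ × Tree) → Tree → Set where
  σ-loc : ∀ {Δ Γ} i j x y → i ≢ j → Γ ‼ i ≡ just x → Γ ‼ j ≡ just y →
          Local σ Δ Γ (node Δ (upd (upd Γ i y) j x))
  π⁺-loc : ∀ {Δ Γ} i x → Γ ‼ i ≡ just x →
          Local π⁺ Δ Γ (node Δ (x ∷ Γ))
  lam-loc : ∀ {Δ Γ} i α β S → Γ ‼ i ≡ just (α , S) → β < α →
          Local lam Δ Γ (node Δ (upd Γ i (β , S)))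
  J-loc : ∀ {Δ Γ} i j α β Δ̃ Γ̃ S → i ≢ j →
          Γ ‼ i ≡ just (α , node Δ̃ Γ̃) → Γ ‼ j ≡ just (β , S) → β < α →
          Local J Δ Γ (node Δ (del (upd Γ i (α , node Δ̃ (Γ̃ ++ [ (β , S) ]))) j))

Step : Rule → Tree → Tree → Set
Step μ T U = Σ Position λ k → Σ (List Var) λ Δ → Σ (List (ℕ × Tree)) λ Γ →
  subtree T k ≡ just (node Δ Γ) × Σ Tree λ V → Local μ Δ Γ V × U ≡ replace T k V

data Steps : List Rule → Tree → Tree → Set where
  done : ∀ {T} → Steps [] T T
  step : ∀ {μ Ω T U S} → Step μ T U → Steps Ω U S → Steps (μ ∷ Ω) T S

Star* : Rule → Tree → Tree → Set
Star* μ = Star (Step μ)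

-- (1) A λ-step only lowers a label. Write T ≥ˡ U when U is T with some labels lowered,
-- anywhere in the tree. Such a U simulates π⁺-steps backwards one for one (the copy is
-- taken of the unlowered child), and every lowering is a sequence of λ-steps.
--
-- (2) Up to reordering children, the effect of π⁺-steps is an expansion T ⇝ U: every
-- child, recursively, is replaced by a nonempty block of expansions of it. Every expansion
-- is realised by π⁺-steps up to reordering, and every reordering by σ-steps. A modal step
-- followed by an expansion is an expansion followed by modal steps, up to reordering: the
-- copies of a lowered child are lowered one by one, and each copy of a J-merged child is
-- rebuilt by J-merging copies of the moved child into a copy of the target. As π⁺-, λ- and
-- J-steps are simulated along reorderings, the expansion is pushed in front of the modal
-- steps one at a time, and the reordering left over becomes the final σ-steps.

module Submission where

open import Defs
open import Data.Nat using (ℕ; zero; suc; _≤_; _<_)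
open import Data.Nat.Properties using (suc-injective; ≤-refl; <⇒≤; m≤n⇒m<n∨m≡n)
open import Data.List using (List; []; _∷_; _++_; [_]; length; replicate)
open import Data.List.Properties using (++-assoc; ++-identityʳ)
open import Data.List.Membership.Propositional using (_∈_)
open import Data.List.Membership.Propositional.Properties using (∈-++⁺ʳ)
open import Data.List.Relation.Unary.Any using (here; there)
open import Data.List.Relation.Unary.All as All using (All; []; _∷_)
open import Data.List.Relation.Unary.All.Properties using (replicate⁺) renaming (++⁺ to All-++⁺)
open import Data.List.Relation.Binary.Pointwise as Pointwise using (Pointwise; []; _∷_)
open import Data.List.Relation.Binary.Permutation.Homogeneous using (Permutation; refl; prep; swap; trans)
open import Data.Maybe using (just)
open import Data.Product using (_×_; _,_; ∃-syntax; proj₁)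
open import Data.Sum using (_⊎_; inj₁; inj₂)
open import Function using (id)
open import Relation.Binary.Bundles using (Setoid)
open import Relation.Binary.PropositionalEquality as ≡ using (_≡_; _≢_; cong; subst; subst₂)
open import Relation.Binary.Construct.Closure.ReflexiveTransitive using (Star; ε; _◅_; _◅◅_; gmap)

Child : Set
Child = ℕ × Tree

variable
  E : Set
  x y z : E
  xs ys zs : List E
  i j k α β : ℕ
  μ : Rule
  Δ : List Var
  Γ Γ′ Γ₀ G : List Child
  R : E → E → Set
  A A′ A₀ B S T T′ U U′ V X : Tree

‼-length : ∀ (xs : List E) x ys → (xs ++ x ∷ ys) ‼ length xs ≡ just x
‼-length []       x ys = ≡.refl
‼-length (_ ∷ xs) x ys = ‼-length xs x ys

upd-length : ∀ (xs : List E) x y ys → upd (xs ++ x ∷ ys) (length xs) y ≡ xs ++ y ∷ ys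
upd-length []       x y ys = ≡.refl
upd-length (w ∷ xs) x y ys = cong (w ∷_) (upd-length xs x y ys)

upd-‼ : ∀ (xs : List E) i → xs ‼ i ≡ just x → upd xs i x ≡ xs
upd-‼ (_ ∷ xs) zero    ≡.refl = ≡.refl
upd-‼ (w ∷ xs) (suc i) e      = cong (w ∷_) (upd-‼ xs i e)

‼-++⁻ : ∀ (xs : List E) ys k → (xs ++ ys) ‼ k ≡ just z →
        (xs ‼ k ≡ just z × (∀ w → upd (xs ++ ys) k w ≡ upd xs k w ++ ys)) ⊎
        (∃[ k′ ] (ys ‼ k′ ≡ just z × (∀ w → upd (xs ++ ys) k w ≡ xs ++ upd ys k′ w)))
‼-++⁻ []       ys k       e = inj₂ (k , e , λ _ → ≡.refl)
‼-++⁻ (_ ∷ xs) ys zero    e = inj₁ (e , λ _ → ≡.refl)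
‼-++⁻ (v ∷ xs) ys (suc k) e with ‼-++⁻ xs ys k e
... | inj₁ (e′ , f)      = inj₁ (e′ , λ w → cong (v ∷_) (f w))
... | inj₂ (k′ , e′ , f) = inj₂ (k′ , e′ , λ w → cong (v ∷_) (f w))

All-‼ : {P : E → Set} → All P xs → xs ‼ k ≡ just z → P z
All-‼ {k = zero}  (p ∷ _)  ≡.refl = p
All-‼ {k = suc k} (_ ∷ ps) e      = All-‼ ps e

All-upd : {P : E → Set} → ∀ k → All P xs → P z → All P (upd xs k z)
All-upd k       []       _  = []
All-upd zero    (_ ∷ ps) pz = pz ∷ ps
All-upd (suc k) (p ∷ ps) pz = p ∷ All-upd k ps pz

data NonEmpty {E : Set} : List E → Set where
  nonEmpty : NonEmpty (x ∷ xs)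

NonEmpty-upd : ∀ k → NonEmpty xs → NonEmpty (upd xs k z)
NonEmpty-upd zero    nonEmpty = nonEmpty
NonEmpty-upd (suc k) nonEmpty = nonEmpty

NonEmpty-++ : NonEmpty xs → NonEmpty (xs ++ ys)
NonEmpty-++ nonEmpty = nonEmpty

NonEmpty-Pointwise⁻ : Pointwise R xs ys → NonEmpty ys → NonEmpty xs
NonEmpty-Pointwise⁻ (_ ∷ _) nonEmpty = nonEmpty

Pointwise-upd : Pointwise R xs ys → ∀ i → R x y → Pointwise R (upd xs i x) (upd ys i y)
Pointwise-upd []        i       r = []
Pointwise-upd (_ ∷ rs)  zero    r = r ∷ rs
Pointwise-upd (r′ ∷ rs) (suc i) r = r′ ∷ Pointwise-upd rs i r

Pointwise-‼ʳ : Pointwise R xs ys → ∀ i → ys ‼ i ≡ just y → ∃[ x ] (xs ‼ i ≡ just x × R x y)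
Pointwise-‼ʳ (r ∷ _)  zero    ≡.refl = _ , ≡.refl , r
Pointwise-‼ʳ (_ ∷ rs) (suc i) l      = Pointwise-‼ʳ rs i l

∈⇒‼ : x ∈ xs → ∃[ i ] (xs ‼ i ≡ just x)
∈⇒‼ (here ≡.refl) = zero , ≡.refl
∈⇒‼ (there x∈xs) with ∈⇒‼ x∈xs
... | i , l = suc i , l

All⇒Pointwise-replicate : All (R x) ys → Pointwise R (replicate (length ys) x) ys
All⇒Pointwise-replicate []       = []
All⇒Pointwise-replicate (r ∷ rs) = r ∷ All⇒Pointwise-replicate rs

-- Rewriting inside trees

data Rewrite (μ : Rule) : Tree → Tree → Set where
  root   : Local μ Δ Γ V → Rewrite μ (node Δ Γ) V
  inside : Γ ‼ i ≡ just (α , A) → Rewrite μ A A′ →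
           Rewrite μ (node Δ Γ) (node Δ (upd Γ i (α , A′)))

subtreeL-‼ : ∀ Γ i r → Γ ‼ i ≡ just (α , A) → subtreeL Γ i r ≡ subtree A r
subtreeL-‼ (_ ∷ Γ) zero    r ≡.refl = ≡.refl
subtreeL-‼ (_ ∷ Γ) (suc i) r e      = subtreeL-‼ Γ i r e

replaceL-‼ : ∀ Γ i r V → Γ ‼ i ≡ just (α , A) → replaceL Γ i r V ≡ upd Γ i (α , replace A r V)
replaceL-‼ (_ ∷ Γ) zero    r V ≡.refl = ≡.refl
replaceL-‼ (c ∷ Γ) (suc i) r V e      = cong (c ∷_) (replaceL-‼ Γ i r V e)

subtreeL-just : ∀ Γ i r → subtreeL Γ i r ≡ just T →
                ∃[ α ] ∃[ A ] (Γ ‼ i ≡ just (α , A) × subtree A r ≡ just T)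
subtreeL-just ((α , A) ∷ Γ) zero    r e = α , A , ≡.refl , e
subtreeL-just (_ ∷ Γ)       (suc i) r e = subtreeL-just Γ i r e

Rewrite⇒Step : Rewrite μ T U → Step μ T U
Rewrite⇒Step (root {Δ} {Γ} {V} l) = [] , Δ , Γ , ≡.refl , V , l , ≡.refl
Rewrite⇒Step (inside {Γ} {i} {Δ = Δ} e s) with Rewrite⇒Step s
... | k , Δ′ , Γ′ , sub , V , l , ≡.refl =
  i ∷ k , Δ′ , Γ′ , ≡.trans (subtreeL-‼ Γ i k e) sub , V , l ,
  cong (node Δ) (≡.sym (replaceL-‼ Γ i k V e))

replace-Rewrite : ∀ k T → subtree T k ≡ just (node Δ Γ) → Local μ Δ Γ V → Rewrite μ T (replace T k V)
replace-Rewrite []      T           ≡.refl l = root l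
replace-Rewrite {V = V} (i ∷ r) (node Δ Γ) e l with subtreeL-just Γ i r e
... | α , A , e′ , sub =
  subst (Rewrite _ _) (cong (node Δ) (≡.sym (replaceL-‼ Γ i r V e′)))
        (inside e′ (replace-Rewrite r A sub l))

Step⇒Rewrite : Step μ T U → Rewrite μ T U
Step⇒Rewrite (k , _ , _ , sub , _ , l , ≡.refl) = replace-Rewrite k _ sub l

data OnChild (_⟶_ : Tree → Tree → Set) : Child → Child → Set where
  child : A ⟶ B → OnChild _⟶_ (α , A) (α , B)

OnChildren : (Tree → Tree → Set) → List Var → List Child → List Child → Set
OnChildren _⟶_ Δ Γ Γ′ = node Δ Γ ⟶ node Δ Γ′

InsideCongruent : (Tree → Tree → Set) → Set
InsideCongruent _⟶_ = ∀ {Δ α A A′} pre post → A ⟶ A′ →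
  OnChildren _⟶_ Δ (pre ++ (α , A) ∷ post) (pre ++ (α , A′) ∷ post)

inside-congruent : InsideCongruent (Rewrite μ)
inside-congruent pre post s =
  subst (Rewrite _ _) (cong (node _) (upd-length pre _ _ post)) (inside (‼-length pre _ post) s)

Modal : Tree → Tree → Set
Modal T U = ∃[ μ ] (IsModal μ × Rewrite μ T U)

Modal-inside-congruent : InsideCongruent Modal
Modal-inside-congruent pre post (μ , m , s) = μ , m , inside-congruent pre post s

module _ {_⟶_ : Tree → Tree → Set} (congruent : InsideCongruent _⟶_) where

  inside⋆ : ∀ pre post → Star _⟶_ A A′ →
            Star (OnChildren _⟶_ Δ) (pre ++ (α , A) ∷ post) (pre ++ (α , A′) ∷ post)
  inside⋆ pre post = gmap _ (congruent pre post)

  insideAll⋆ : ∀ pre → Pointwise (OnChild (Star _⟶_)) xs ys →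
               Star (OnChildren _⟶_ Δ) (pre ++ xs) (pre ++ ys)
  insideAll⋆ pre []                                = ε
  insideAll⋆ pre (child {B = A′} {α = α} ss ∷ sss) =
    inside⋆ pre _ ss ◅◅
    subst₂ (Star _) (++-assoc pre _ _) (++-assoc pre _ _) (insideAll⋆ (pre ++ [ α , A′ ]) sss)

Rewrite-∷ : μ ≢ π⁺ → OnChildren (Rewrite μ) Δ Γ Γ′ →
            OnChildren (Rewrite μ) Δ (x ∷ Γ) (x ∷ Γ′)
Rewrite-∷ μ≢π⁺ (root (σ-loc i j x y i≢j eᵢ eⱼ)) =
  root (σ-loc (suc i) (suc j) x y (λ e → i≢j (suc-injective e)) eᵢ eⱼ)
Rewrite-∷ μ≢π⁺ (root (π⁺-loc i x e)) with () ← μ≢π⁺ ≡.refl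
Rewrite-∷ μ≢π⁺ (root (lam-loc i α β S e β<α)) = root (lam-loc (suc i) α β S e β<α)
Rewrite-∷ μ≢π⁺ (root (J-loc i j α β Δ̃ Γ̃ S i≢j eᵢ eⱼ β<α)) =
  root (J-loc (suc i) (suc j) α β Δ̃ Γ̃ S (λ e → i≢j (suc-injective e)) eᵢ eⱼ β<α)
Rewrite-∷ μ≢π⁺ (inside {i = i} e s) = inside {i = suc i} e s

Rewrite-∷⋆ : μ ≢ π⁺ → Star (OnChildren (Rewrite μ) Δ) Γ Γ′ →
             Star (OnChildren (Rewrite μ) Δ) (x ∷ Γ) (x ∷ Γ′)
Rewrite-∷⋆ μ≢π⁺ = gmap _ (Rewrite-∷ μ≢π⁺)

-- Reordering children

data _≃_ : Tree → Tree → Set where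
  node : Permutation (OnChild _≃_) Γ Γ′ → node Δ Γ ≃ node Δ Γ′

_≃ᶜ_ : Child → Child → Set
_≃ᶜ_ = OnChild _≃_

mutual
  ≃-refl : ∀ T → T ≃ T
  ≃-refl (node Δ Γ) = node (refl (≋-refl Γ))

  ≋-refl : ∀ Γ → Pointwise _≃ᶜ_ Γ Γ
  ≋-refl []            = []
  ≋-refl ((α , A) ∷ Γ) = child (≃-refl A) ∷ ≋-refl Γ

mutual
  ≃-sym : T ≃ U → U ≃ T
  ≃-sym (node p) = node (↭-sym′ p)

  ≃ᶜ-sym : x ≃ᶜ y → y ≃ᶜ x
  ≃ᶜ-sym (child e) = child (≃-sym e)

  ≋-sym : Pointwise _≃ᶜ_ xs ys → Pointwise _≃ᶜ_ ys xs
  ≋-sym []       = []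
  ≋-sym (e ∷ es) = ≃ᶜ-sym e ∷ ≋-sym es

  ↭-sym′ : Permutation _≃ᶜ_ xs ys → Permutation _≃ᶜ_ ys xs
  ↭-sym′ (refl es)    = refl (≋-sym es)
  ↭-sym′ (prep e p)   = prep (≃ᶜ-sym e) (↭-sym′ p)
  ↭-sym′ (swap e f p) = swap (≃ᶜ-sym f) (≃ᶜ-sym e) (↭-sym′ p)
  ↭-sym′ (trans p q)  = trans (↭-sym′ q) (↭-sym′ p)

≃-trans : T ≃ U → U ≃ V → T ≃ V
≃-trans (node p) (node q) = node (trans p q)

≃ᶜ-trans : x ≃ᶜ y → y ≃ᶜ z → x ≃ᶜ z
≃ᶜ-trans (child e) (child f) = child (≃-trans e f)

≃ᶜ-setoid : Setoid _ _
≃ᶜ-setoid = record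
  { Carrier = Child
  ; _≈_ = _≃ᶜ_
  ; isEquivalence = record { refl = λ {c} → ≃ᶜ-refl c ; sym = ≃ᶜ-sym ; trans = ≃ᶜ-trans }
  }
  where
  ≃ᶜ-refl : ∀ c → c ≃ᶜ c
  ≃ᶜ-refl (α , A) = child (≃-refl A)

open import Data.List.Relation.Binary.Permutation.Setoid ≃ᶜ-setoid
  using (_↭_; ↭-refl; ↭-sym; ↭-reflexive; ↭-prep; ↭-swap)
open import Data.List.Relation.Binary.Permutation.Setoid.Properties ≃ᶜ-setoid
  using (↭-shift; ++⁺; ++⁺ˡ; ++-comm; shifts)

upd-↭-∷del : ∀ Γ i → Γ ‼ i ≡ just x → upd Γ i y ↭ y ∷ del Γ i
upd-↭-∷del (_ ∷ Γ) zero    _ = ↭-refl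
upd-↭-∷del (c ∷ Γ) (suc i) e = trans (↭-prep c (upd-↭-∷del Γ i e)) (↭-swap c _ ↭-refl)

‼-↭-∷del : ∀ Γ i → Γ ‼ i ≡ just x → Γ ↭ x ∷ del Γ i
‼-↭-∷del {x} Γ i e = subst (_↭ x ∷ del Γ i) (upd-‼ Γ i e) (upd-↭-∷del Γ i e)

≋-‼ : Pointwise _≃ᶜ_ Γ Γ′ → ∀ i → Γ ‼ i ≡ just x →
      ∃[ x′ ] (Γ′ ‼ i ≡ just x′ × x ≃ᶜ x′ × del Γ i ↭ del Γ′ i)
≋-‼ (e ∷ es) zero    ≡.refl = _ , ≡.refl , e , refl es
≋-‼ (e ∷ es) (suc i) l with ≋-‼ es i l
... | x′ , l′ , e′ , q = x′ , l′ , e′ , prep e q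

↭-‼ : Γ ↭ Γ′ → ∀ i → Γ ‼ i ≡ just x →
      ∃[ i′ ] ∃[ x′ ] (Γ′ ‼ i′ ≡ just x′ × x ≃ᶜ x′ × del Γ i ↭ del Γ′ i′)
↭-‼ (refl es) i l = i , ≋-‼ es i l
↭-‼ (prep e p) zero ≡.refl = zero , _ , ≡.refl , e , p
↭-‼ (prep e p) (suc i) l with ↭-‼ p i l
... | i′ , x′ , l′ , e′ , q = suc i′ , x′ , l′ , e′ , prep e q
↭-‼ (swap e f p) zero          ≡.refl = 1 , _ , ≡.refl , e , prep f p
↭-‼ (swap e f p) (suc zero)    ≡.refl = 0 , _ , ≡.refl , f , prep e p
↭-‼ (swap e f p) (suc (suc i)) l with ↭-‼ p i l
... | i′ , x′ , l′ , e′ , q = suc (suc i′) , x′ , l′ , e′ , swap e f q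
↭-‼ (trans p q) i l with ↭-‼ p i l
... | i₁ , x₁ , l₁ , e₁ , r₁ with ↭-‼ q i₁ l₁
... | i₂ , x₂ , l₂ , e₂ , r₂ = i₂ , x₂ , l₂ , ≃ᶜ-trans e₁ e₂ , trans r₁ r₂

↭-upd : ∀ {x′ y′} Γ Γ′ i i′ → Γ ‼ i ≡ just x → Γ′ ‼ i′ ≡ just x′ →
        del Γ i ↭ del Γ′ i′ → y ≃ᶜ y′ → upd Γ i y ↭ upd Γ′ i′ y′
↭-upd Γ Γ′ i i′ l l′ p e =
  trans (upd-↭-∷del Γ i l) (trans (prep e p) (↭-sym (upd-↭-∷del Γ′ i′ l′)))

↭-∷∷del : ∀ Γ i j → Γ ‼ i ≡ just x → Γ ‼ j ≡ just y → i ≢ j →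
          ∃[ Γᵣ ] (Γ ↭ x ∷ y ∷ Γᵣ × (∀ x′ → del (upd Γ i x′) j ↭ x′ ∷ Γᵣ))
↭-∷∷del (c ∷ Γ) zero zero _ _ i≢j with () ← i≢j ≡.refl
↭-∷∷del (c ∷ Γ) zero (suc j) ≡.refl lⱼ _ =
  del Γ j , ↭-prep c (‼-↭-∷del Γ j lⱼ) , λ _ → ↭-refl
↭-∷∷del (c ∷ Γ) (suc i) zero lᵢ ≡.refl _ =
  del Γ i , trans (↭-prep c (‼-↭-∷del Γ i lᵢ)) (↭-swap c _ ↭-refl) ,
  λ x′ → upd-↭-∷del Γ i lᵢ
↭-∷∷del {x} {y} (c ∷ Γ) (suc i) (suc j) lᵢ lⱼ i≢j
  with ↭-∷∷del Γ i j lᵢ lⱼ (λ e → i≢j (cong suc e))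
... | Γᵣ , p , f =
  c ∷ Γᵣ , trans (↭-prep c p) (trans (↭-swap c x ↭-refl) (↭-prep x (↭-swap c y ↭-refl))) ,
  λ x′ → trans (↭-prep c (f x′)) (↭-swap c x′ ↭-refl)

del-‼ : ∀ Γ i j″ → Γ ‼ i ≡ just x → del Γ i ‼ j″ ≡ just y →
        ∃[ j ] (i ≢ j × Γ ‼ j ≡ just y ×
                (∀ x′ → del (upd Γ i x′) j ↭ x′ ∷ del (del Γ i) j″))
del-‼ (c ∷ Γ) zero j″ _ lⱼ = suc j″ , (λ ()) , lⱼ , λ _ → ↭-refl
del-‼ (c ∷ Γ) (suc i) zero lᵢ ≡.refl = zero , (λ ()) , ≡.refl , λ x′ → upd-↭-∷del Γ i lᵢ
del-‼ (c ∷ Γ) (suc i) (suc j″) lᵢ lⱼ with del-‼ Γ i j″ lᵢ lⱼ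
... | j , i≢j , l , f =
  suc j , (λ e → i≢j (suc-injective e)) , l , λ x′ → trans (↭-prep c (f x′)) (↭-swap c x′ ↭-refl)

LocalRespects↭ : Rule → Set
LocalRespects↭ μ = ∀ {Δ Γ Γ′ V} → Γ ↭ Γ′ → Local μ Δ Γ V →
                   ∃[ V′ ] (Local μ Δ Γ′ V′ × V ≃ V′)

π⁺-respects-↭ : LocalRespects↭ π⁺
π⁺-respects-↭ p (π⁺-loc i x l) with ↭-‼ p i l
... | i′ , x′ , l′ , e , _ = _ , π⁺-loc i′ x′ l′ , node (prep e p)

lam-respects-↭ : LocalRespects↭ lam
lam-respects-↭ {Γ = Γ} {Γ′} p (lam-loc i α β S l β<α) with ↭-‼ p i l
... | i′ , (_ , S′) , l′ , child e , q =
  _ , lam-loc i′ α β S′ l′ β<α , node (↭-upd Γ Γ′ i i′ l l′ q (child e))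

J-respects-↭ : LocalRespects↭ J
J-respects-↭ {Γ = Γ} {Γ′} p (J-loc i j α β Δ̃ Γ̃ S i≢j lᵢ lⱼ β<α)
  with ↭-∷∷del Γ i j lᵢ lⱼ i≢j
... | _ , pΓ , f with ↭-‼ (trans (↭-sym pΓ) p) zero ≡.refl
... | i′ , (_ , node _ Γ̃′) , lᵢ′ , child (node pΓ̃) , q₁ with ↭-‼ q₁ zero ≡.refl
... | j″ , (_ , S′) , lⱼ″ , child eS , q₂ with del-‼ Γ′ i′ j″ lᵢ′ lⱼ″
... | j′ , i′≢j′ , lⱼ′ , g =
  _ , J-loc i′ j′ α β Δ̃ Γ̃′ S′ i′≢j′ lᵢ′ lⱼ′ β<α ,
  node (trans (f _) (trans (prep (child (node (++⁺ pΓ̃ (prep (child eS) ↭-refl)))) q₂) (↭-sym (g _))))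

≃-Simulates : (Tree → Tree → Set) → Set
≃-Simulates _⟶_ = ∀ {T T′ U} → T ≃ T′ → T ⟶ U → ∃[ U′ ] (T′ ⟶ U′ × U ≃ U′)

Rewrite-≃-simulates : LocalRespects↭ μ → ≃-Simulates (Rewrite μ)
Rewrite-≃-simulates resp (node p) (root l) with resp p l
... | V′ , l′ , e = V′ , root l′ , e
Rewrite-≃-simulates resp (node {Γ = Γ} {Γ′} p) (inside {i = i} l s) with ↭-‼ p i l
... | i′ , _ , l′ , child e , q with Rewrite-≃-simulates resp e s
... | _ , s′ , e′ = _ , inside l′ s′ , node (↭-upd Γ Γ′ i i′ l l′ q (child e′))

Star-≃-simulates : ∀ {_⟶_} → ≃-Simulates _⟶_ → ≃-Simulates (Star _⟶_)
Star-≃-simulates sim e ε = _ , ε , e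
Star-≃-simulates sim e (s ◅ ss) with sim e s
... | _ , s′ , e′ with Star-≃-simulates sim e′ ss
... | _ , ss′ , e″ = _ , s′ ◅ ss′ , e″

modal-respects-↭ : IsModal μ → LocalRespects↭ μ
modal-respects-↭ lam-modal = lam-respects-↭
modal-respects-↭ J-modal   = J-respects-↭

Modal-≃-simulates : ≃-Simulates Modal
Modal-≃-simulates e (μ , m , s) with Rewrite-≃-simulates (modal-respects-↭ m) e s
... | _ , s′ , e′ = _ , (μ , m , s′) , e′

mutual
  ≃⇒σ⋆ : T ≃ U → Star (Rewrite σ) T U
  ≃⇒σ⋆ (node p) = gmap (node _) id (↭⇒σ⋆ p)

  ≃ᶜ⇒σ⋆ : x ≃ᶜ y → Star (OnChildren (Rewrite σ) Δ) (x ∷ xs) (y ∷ xs)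
  ≃ᶜ⇒σ⋆ {xs = xs} (child e) = inside⋆ inside-congruent [] xs (≃⇒σ⋆ e)

  ≋⇒σ⋆ : Pointwise _≃ᶜ_ xs ys → Star (OnChildren (Rewrite σ) Δ) xs ys
  ≋⇒σ⋆ []       = ε
  ≋⇒σ⋆ (e ∷ es) = ≃ᶜ⇒σ⋆ e ◅◅ Rewrite-∷⋆ (λ ()) (≋⇒σ⋆ es)

  ↭⇒σ⋆ : xs ↭ ys → Star (OnChildren (Rewrite σ) Δ) xs ys
  ↭⇒σ⋆ (refl es)   = ≋⇒σ⋆ es
  ↭⇒σ⋆ (prep e p)  = ≃ᶜ⇒σ⋆ e ◅◅ Rewrite-∷⋆ (λ ()) (↭⇒σ⋆ p)
  ↭⇒σ⋆ (swap {x = x} {y} e f p) =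
    root (σ-loc 0 1 x y (λ ()) ≡.refl ≡.refl) ◅
    (≃ᶜ⇒σ⋆ f ◅◅ Rewrite-∷⋆ (λ ()) (≃ᶜ⇒σ⋆ e ◅◅ Rewrite-∷⋆ (λ ()) (↭⇒σ⋆ p)))
  ↭⇒σ⋆ (trans p q) = ↭⇒σ⋆ p ◅◅ ↭⇒σ⋆ q

-- Expansions

data Blocks (R : Child → Child → Set) : List Child → List Child → Set where
  []    : Blocks R [] []
  block : NonEmpty ys → All (R x) ys → Blocks R xs zs → Blocks R (x ∷ xs) (ys ++ zs)

Blocks-singleton : NonEmpty ys → All (R x) ys → Blocks R [ x ] ys
Blocks-singleton {ys = ys} ne rs = subst (Blocks _ _) (++-identityʳ ys) (block ne rs [])

Blocks-++ : ∀ {xs′ ys′} → Blocks R xs ys → Blocks R xs′ ys′ → Blocks R (xs ++ xs′) (ys ++ ys′)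
Blocks-++ []                                b′ = b′
Blocks-++ (block {ys = ys} {zs = zs} ne rs b) b′ =
  subst (Blocks _ _) (≡.sym (++-assoc ys zs _)) (block ne rs (Blocks-++ b b′))

module _ (R-respˡ : ∀ {x x′ y} → x ≃ᶜ x′ → R x′ y → R x y) where

  Blocks-resp-≋ˡ : Pointwise _≃ᶜ_ Γ Γ′ → Blocks R Γ′ G → Blocks R Γ G
  Blocks-resp-≋ˡ []       []               = []
  Blocks-resp-≋ˡ (e ∷ es) (block ne rs b) = block ne (All.map (R-respˡ e) rs) (Blocks-resp-≋ˡ es b)

  Blocks-resp-↭ˡ : Γ ↭ Γ′ → Blocks R Γ′ G → ∃[ G′ ] (Blocks R Γ G′ × G′ ↭ G)
  Blocks-resp-↭ˡ (refl es) b = _ , Blocks-resp-≋ˡ es b , ↭-refl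
  Blocks-resp-↭ˡ (prep e p) (block {ys = ys} ne rs b) with Blocks-resp-↭ˡ p b
  ... | G′ , b′ , q = ys ++ G′ , block ne (All.map (R-respˡ e) rs) b′ , ++⁺ˡ ys q
  Blocks-resp-↭ˡ (swap e f p) (block {ys = ys₁} ne₁ rs₁ (block {ys = ys₂} ne₂ rs₂ b))
    with Blocks-resp-↭ˡ p b
  ... | G′ , b′ , q =
    ys₂ ++ ys₁ ++ G′ ,
    block ne₂ (All.map (R-respˡ e) rs₂) (block ne₁ (All.map (R-respˡ f) rs₁) b′) ,
    trans (shifts ys₂ ys₁) (++⁺ˡ ys₁ (++⁺ˡ ys₂ q))
  Blocks-resp-↭ˡ (trans p q) b with Blocks-resp-↭ˡ q b
  ... | G₁ , b₁ , r₁ with Blocks-resp-↭ˡ p b₁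
  ... | G₂ , b₂ , r₂ = G₂ , b₂ , trans r₂ r₁

Blocks-‼ : Blocks R Γ G → ∀ k → G ‼ k ≡ just z →
           ∃[ x ] (R x z × (∀ w → R x w → Blocks R Γ (upd G k w)))
Blocks-‼ (block {ys = ys} {x = x} {zs = zs} ne rs b) k l with ‼-++⁻ ys zs k l
... | inj₁ (l′ , f) =
  x , All-‼ rs l′ , λ w r → subst (Blocks _ _) (≡.sym (f w)) (block (NonEmpty-upd k ne) (All-upd k rs r) b)
... | inj₂ (k′ , l′ , f) with Blocks-‼ b k′ l′
... | x′ , r , h = x′ , r , λ w r′ → subst (Blocks _ _) (≡.sym (f w)) (block ne rs (h w r′))

Blocks-dup : Blocks R Γ G → ∀ k → G ‼ k ≡ just z → ∃[ G′ ] (Blocks R Γ G′ × G′ ↭ z ∷ G)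
Blocks-dup {z = z} (block {ys = ys} {zs = zs} ne rs b) k l with ‼-++⁻ ys zs k l
... | inj₁ (l′ , _) = (z ∷ ys) ++ zs , block nonEmpty (All-‼ rs l′ ∷ rs) b , ↭-refl
... | inj₂ (k′ , l′ , _) with Blocks-dup b k′ l′
... | G′ , b′ , p = ys ++ G′ , block ne rs b′ , trans (++⁺ˡ ys p) (↭-shift ys zs)

data _⇝_ : Tree → Tree → Set where
  node : Γ ↭ Γ₀ → Blocks (OnChild _⇝_) Γ₀ G → G ↭ Γ′ → node Δ Γ ⇝ node Δ Γ′

_⇝ᶜ_ : Child → Child → Set
_⇝ᶜ_ = OnChild _⇝_

mutual
  ⇝-refl : ∀ T → T ⇝ T
  ⇝-refl (node Δ Γ) = node ↭-refl (Blocks-refl Γ) ↭-refl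

  Blocks-refl : ∀ Γ → Blocks _⇝ᶜ_ Γ Γ
  Blocks-refl []            = []
  Blocks-refl ((α , A) ∷ Γ) = block nonEmpty (child (⇝-refl A) ∷ []) (Blocks-refl Γ)

⇝ᶜ-respˡ : x ≃ᶜ y → y ⇝ᶜ z → x ⇝ᶜ z
⇝ᶜ-respˡ (child (node p)) (child (node q b r)) = child (node (trans p q) b r)

⇝ᶜ-respʳ : x ⇝ᶜ y → y ≃ᶜ z → x ⇝ᶜ z
⇝ᶜ-respʳ (child (node q b r)) (child (node p)) = child (node q b (trans r p))

⇝-π⁺ : T ⇝ U → Rewrite π⁺ U V → T ⇝ V
⇝-π⁺ (node p b q) (root (π⁺-loc i x l)) with ↭-‼ (↭-sym q) i l
... | k , z , lₖ , x≃z , _ with Blocks-dup b k lₖ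
... | G′ , b′ , r = node p b′ (trans r (prep (≃ᶜ-sym x≃z) q))
⇝-π⁺ (node p b q) (inside {i = i} l s) with ↭-‼ (↭-sym q) i l
... | k , z , lₖ , child c , r with Blocks-‼ b k lₖ
... | x , d , h with ⇝ᶜ-respʳ d (child (≃-sym c))
... | child d′ = node p (h _ (child (⇝-π⁺ d′ s))) (↭-upd _ _ k i lₖ l (↭-sym r) (child (≃-refl _)))

⇝-π⁺⋆ : T ⇝ U → Star (Rewrite π⁺) U V → T ⇝ V
⇝-π⁺⋆ d ε        = d
⇝-π⁺⋆ d (s ◅ ss) = ⇝-π⁺⋆ (⇝-π⁺ d s) ss

_⟶⋆[_]≃_ : Tree → Rule → Tree → Set
T ⟶⋆[ μ ]≃ U = ∃[ T′ ] (Star (Rewrite μ) T T′ × T′ ≃ U)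

π⁺-prepend⋆ : ∀ {ws} → All (_∈ Γ) ws → Star (OnChildren (Rewrite π⁺) Δ) Γ (ws ++ Γ)
π⁺-prepend⋆ []                                = ε
π⁺-prepend⋆ {ws = w ∷ ws} (w∈Γ ∷ ws∈Γ) with ∈⇒‼ (∈-++⁺ʳ ws w∈Γ)
... | i , l = π⁺-prepend⋆ ws∈Γ ◅◅ root (π⁺-loc i w l) ◅ ε

Blocks-decompose : Blocks R Γ G →
  ∃[ ws ] ∃[ Gʷ ] ∃[ Gᵒ ]
    (All (_∈ Γ) ws × Pointwise R ws Gʷ × Pointwise R Γ Gᵒ × Gʷ ++ Gᵒ ↭ G)
Blocks-decompose [] = [] , [] , [] , [] , [] , [] , ↭-refl
Blocks-decompose (block {ys = y ∷ ys} {x = x} {zs = zs} nonEmpty (r ∷ rs) b) with Blocks-decompose b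
... | ws , Gʷ , Gᵒ , ws∈ , rʷ , rᵒ , p =
  replicate (length ys) x ++ ws , ys ++ Gʷ , y ∷ Gᵒ ,
  All-++⁺ (replicate⁺ (length ys) (here ≡.refl)) (All.map there ws∈) ,
  Pointwise.++⁺ (All⇒Pointwise-replicate rs) rʷ , r ∷ rᵒ ,
  trans (↭-shift (ys ++ Gʷ) Gᵒ) (↭-prep y (trans (↭-reflexive (++-assoc ys Gʷ Gᵒ)) (++⁺ˡ ys p)))

Pointwise-realize : Pointwise (OnChild _⟶⋆[ π⁺ ]≃_) Γ G →
                    ∃[ L ] (Pointwise (OnChild (Star (Rewrite π⁺))) Γ L × Pointwise _≃ᶜ_ L G)
Pointwise-realize []                          = [] , [] , []
Pointwise-realize (child (_ , ss , e) ∷ rs) with Pointwise-realize rs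
... | L , sss , es = _ ∷ L , child ss ∷ sss , child e ∷ es

-- The extra copies are all made first, at the root; then every child is expanded in place.
Blocks-realize : Blocks (OnChild _⟶⋆[ π⁺ ]≃_) Γ G →
                 ∃[ L ] (Star (OnChildren (Rewrite π⁺) Δ) Γ L × L ↭ G)
Blocks-realize b with Blocks-decompose b
... | _ , _ , _ , ws∈ , rʷ , rᵒ , p with Pointwise-realize (Pointwise.++⁺ rʷ rᵒ)
... | L , sss , es = L , π⁺-prepend⋆ ws∈ ◅◅ insideAll⋆ inside-congruent [] sss , trans (refl es) p

mutual
  ⇝⇒⟶⋆≃ : T ⇝ U → T ⟶⋆[ π⁺ ]≃ U
  ⇝⇒⟶⋆≃ (node p b q) with Blocks-realize (Blocks-⇝⇒⟶⋆≃ b)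
  ... | L , ss , r
    with Star-≃-simulates (Rewrite-≃-simulates π⁺-respects-↭) (node (↭-sym p)) (gmap (node _) id ss)
  ... | T′ , ss′ , e = T′ , ss′ , ≃-trans (≃-sym e) (node (trans r q))

  Blocks-⇝⇒⟶⋆≃ : Blocks _⇝ᶜ_ Γ G → Blocks (OnChild _⟶⋆[ π⁺ ]≃_) Γ G
  Blocks-⇝⇒⟶⋆≃ []              = []
  Blocks-⇝⇒⟶⋆≃ (block ne ds b) = block ne (All-⇝⇒⟶⋆≃ ds) (Blocks-⇝⇒⟶⋆≃ b)

  All-⇝⇒⟶⋆≃ : All (x ⇝ᶜ_) ys → All (OnChild _⟶⋆[ π⁺ ]≃_ x) ys
  All-⇝⇒⟶⋆≃ []             = []
  All-⇝⇒⟶⋆≃ (child d ∷ ds) = child (⇝⇒⟶⋆≃ d) ∷ All-⇝⇒⟶⋆≃ ds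

-- Lowering labels

mutual
  data _≥ˡ_ : Tree → Tree → Set where
    node : Pointwise _≥ˡᶜ_ Γ Γ′ → node Δ Γ ≥ˡ node Δ Γ′

  data _≥ˡᶜ_ : Child → Child → Set where
    child : β ≤ α → A ≥ˡ B → (α , A) ≥ˡᶜ (β , B)

mutual
  ≥ˡ-refl : ∀ T → T ≥ˡ T
  ≥ˡ-refl (node Δ Γ) = node (≥ˡᴸ-refl Γ)

  ≥ˡᴸ-refl : ∀ Γ → Pointwise _≥ˡᶜ_ Γ Γ
  ≥ˡᴸ-refl []            = []
  ≥ˡᴸ-refl ((α , A) ∷ Γ) = child ≤-refl (≥ˡ-refl A) ∷ ≥ˡᴸ-refl Γ

≥ˡ-upd : ∀ Γ i → Γ ‼ i ≡ just x → x ≥ˡᶜ y → Pointwise _≥ˡᶜ_ Γ (upd Γ i y)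
≥ˡ-upd Γ i l r =
  subst (λ Γ₁ → Pointwise _≥ˡᶜ_ Γ₁ _) (upd-‼ Γ i l) (Pointwise-upd (≥ˡᴸ-refl Γ) i r)

lam⇒≥ˡ : Rewrite lam T U → T ≥ˡ U
lam⇒≥ˡ (root (lam-loc {Γ = Γ} i α β S l β<α)) = node (≥ˡ-upd Γ i l (child (<⇒≤ β<α) (≥ˡ-refl S)))
lam⇒≥ˡ (inside {Γ = Γ} {i} l s)              = node (≥ˡ-upd Γ i l (child ≤-refl (lam⇒≥ˡ s)))

≥ˡ-π⁺ : T ≥ˡ U → Rewrite π⁺ U U′ → ∃[ T′ ] (Rewrite π⁺ T T′ × T′ ≥ˡ U′)
≥ˡ-π⁺ (node ls) (root (π⁺-loc i y l)) with Pointwise-‼ʳ ls i l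
... | x , l′ , r = _ , root (π⁺-loc i x l′) , node (r ∷ ls)
≥ˡ-π⁺ (node ls) (inside {i = i} l s) with Pointwise-‼ʳ ls i l
... | _ , l′ , child β≤α r with ≥ˡ-π⁺ r s
... | _ , s′ , r′ = _ , inside l′ s′ , node (Pointwise-upd ls i (child β≤α r′))

≥ˡ-π⁺-steps : ∀ n → T ≥ˡ U → Steps (replicate n π⁺) U U′ →
              ∃[ T′ ] (Steps (replicate n π⁺) T T′ × T′ ≥ˡ U′)
≥ˡ-π⁺-steps zero    r done          = _ , done , r
≥ˡ-π⁺-steps (suc n) r (step s ss) with ≥ˡ-π⁺ r (Step⇒Rewrite s)
... | _ , s′ , r′ with ≥ˡ-π⁺-steps n r′ ss
... | _ , ss′ , r″ = _ , step (Rewrite⇒Step s′) ss′ , r″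

mutual
  ≥ˡ⇒lam⋆ : T ≥ˡ U → Star (Rewrite lam) T U
  ≥ˡ⇒lam⋆ (node ls) = gmap (node _) id (≥ˡᴸ⇒lam⋆ ls)

  ≥ˡᴸ⇒lam⋆ : Pointwise _≥ˡᶜ_ Γ Γ′ → Star (OnChildren (Rewrite lam) Δ) Γ Γ′
  ≥ˡᴸ⇒lam⋆ []                                 = ε
  ≥ˡᴸ⇒lam⋆ {Δ = Δ} (_∷_ {xs = Γ} (child {β} {α} {A} {B} β≤α r) ls) =
    inside⋆ inside-congruent [] Γ (≥ˡ⇒lam⋆ r) ◅◅ lower-head (m≤n⇒m<n∨m≡n β≤α) ◅◅
    Rewrite-∷⋆ (λ ()) (≥ˡᴸ⇒lam⋆ ls)
    where
    lower-head : β < α ⊎ β ≡ α → Star (OnChildren (Rewrite lam) Δ) ((α , B) ∷ Γ) ((β , B) ∷ Γ)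
    lower-head (inj₁ β<α)    = root (lam-loc zero α β B ≡.refl β<α) ◅ ε
    lower-head (inj₂ ≡.refl) = ε

-- Modal steps before expansions

ExpandThenModal : Tree → Tree → Set
ExpandThenModal T X = ∃[ Y ] ∃[ Z ] (T ⇝ Y × Star Modal Y Z × Z ≃ X)

-- A root step turns the children cs into the single child c; the expansions ys of c must be
-- rebuilt by modal steps from an expansion of cs.
BlockCommutes : List Child → Child → Set
BlockCommutes cs c = ∀ {ys} → NonEmpty ys → All (c ⇝ᶜ_) ys →
  ∃[ Bs ] ∃[ Ys ] ∃[ Zs ] (Blocks _⇝ᶜ_ cs Bs × Bs ↭ Ys ×
    (∀ {Δ} rest → Star (OnChildren Modal Δ) (Ys ++ rest) (Zs ++ rest)) × Zs ↭ ys)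

root-commutes : ∀ {cs c Γᵣ Γ₁} → Γ ↭ cs ++ Γᵣ → Γ₁ ↭ c ∷ Γᵣ → BlockCommutes cs c →
                node Δ Γ₁ ⇝ X → ExpandThenModal (node Δ Γ) X
root-commutes pΓ pΓ₁ commutes (node p b q) with Blocks-resp-↭ˡ ⇝ᶜ-respˡ (trans (↭-sym pΓ₁) p) b
... | _ , block {zs = zs} ne ds b′ , r with commutes ne ds
... | _ , Ys , Zs , bs , pY , steps , pZ =
  node _ (Ys ++ zs) , node _ (Zs ++ zs) , node pΓ (Blocks-++ bs b′) (++⁺ pY ↭-refl) ,
  gmap (node _) id (steps zs) , node (trans (++⁺ pZ ↭-refl) (trans r q))

inside-commutes-each : (∀ {B} → A₀ ⇝ B → ExpandThenModal A B) → All ((α , A₀) ⇝ᶜ_) ys →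
  ∃[ Ys ] ∃[ Zs ]
  (All ((α , A) ⇝ᶜ_) Ys × Pointwise (OnChild (Star Modal)) Ys Zs × Pointwise _≃ᶜ_ Zs ys)
inside-commutes-each ih []             = [] , [] , [] , [] , []
inside-commutes-each ih (child d ∷ ds) with ih d | inside-commutes-each ih ds
... | Y , Z , d′ , ss , e | Ys , Zs , ds′ , sss , es =
  (_ , Y) ∷ Ys , (_ , Z) ∷ Zs , child d′ ∷ ds′ , child ss ∷ sss , child e ∷ es

inside-commutes : (∀ {B} → A₀ ⇝ B → ExpandThenModal A B) → BlockCommutes [ α , A ] (α , A₀)
inside-commutes ih ne ds with inside-commutes-each ih ds
... | Ys , Zs , ds′ , sss , es =
  Ys , Ys , Zs , Blocks-singleton (NonEmpty-Pointwise⁻ sss (NonEmpty-Pointwise⁻ es ne)) ds′ , ↭-refl ,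
  (λ rest → insideAll⋆ Modal-inside-congruent [] (Pointwise.++⁺ sss (Pointwise.refl (child ε)))) , refl es

raise-labels : β ≤ α → All ((β , S) ⇝ᶜ_) ys →
               ∃[ Ys ] (All ((α , S) ⇝ᶜ_) Ys × Pointwise _≥ˡᶜ_ Ys ys)
raise-labels β≤α []                      = [] , [] , []
raise-labels β≤α (child {B = B} d ∷ ds) with raise-labels β≤α ds
... | Ys , ds′ , ls = (_ , B) ∷ Ys , child d ∷ ds′ , child β≤α (≥ˡ-refl B) ∷ ls

lam-commutes : β < α → BlockCommutes [ α , S ] (β , S)
lam-commutes β<α ne ds with raise-labels (<⇒≤ β<α) ds
... | Ys , ds′ , ls =
  Ys , Ys , _ , Blocks-singleton (NonEmpty-Pointwise⁻ ls ne) ds′ , ↭-refl ,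
  (λ rest → gmap id (λ s → lam , lam-modal , s) (≥ˡᴸ⇒lam⋆ (Pointwise.++⁺ ls (≥ˡᴸ-refl rest)))) ,
  ↭-refl

J-split : ∀ {Δ̃ Γ̃} → (α , node Δ̃ (Γ̃ ++ [ β , S ])) ⇝ᶜ y →
  ∃[ us ] ∃[ ws ] ((α , node Δ̃ Γ̃) ⇝ᶜ (α , node Δ̃ us) × NonEmpty ws × All ((β , S) ⇝ᶜ_) ws ×
                   (α , node Δ̃ (us ++ ws)) ≃ᶜ y)
J-split {β = β} {S} {Γ̃ = Γ̃} (child (node p b q))
  with Blocks-resp-↭ˡ ⇝ᶜ-respˡ (trans (++-comm [ β , S ] Γ̃) p) b
... | _ , block {ys = ws} {zs = us} ne ds bᵤ , r =
  us , ws , child (node ↭-refl bᵤ ↭-refl) , ne , ds , child (node (trans (++-comm us ws) (trans r q)))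

J-merge⋆ : ∀ {Δ̃} u ws rest → All (λ w → proj₁ w < α) ws →
           Star (OnChildren (Rewrite J) Δ) ((α , node Δ̃ u) ∷ ws ++ rest) ((α , node Δ̃ (u ++ ws)) ∷ rest)
J-merge⋆ {α = α} {Δ = Δ} {Δ̃} u [] rest [] =
  subst (λ v → Star (OnChildren (Rewrite J) Δ) ((α , node Δ̃ u) ∷ rest) ((α , node Δ̃ v) ∷ rest))
        (≡.sym (++-identityʳ u)) ε
J-merge⋆ {α = α} {Δ = Δ} {Δ̃} u ((β , S) ∷ ws) rest (β<α ∷ β′<α) =
  root (J-loc 0 1 α β Δ̃ u S (λ ()) ≡.refl ≡.refl β<α) ◅
  subst (λ v → Star (OnChildren (Rewrite J) Δ) ((α , node Δ̃ (u ++ [ β , S ])) ∷ ws ++ rest)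
                                             ((α , node Δ̃ v) ∷ rest))
        (++-assoc u [ β , S ] ws) (J-merge⋆ (u ++ [ β , S ]) ws rest β′<α)

-- Each copy of the merged child is rebuilt from a copy of the target followed directly by its
-- copies of the moved child, so Ys interleaves Xs and Ws.
J-commutes-each : ∀ {Δ̃ Γ̃} → β < α → All ((α , node Δ̃ (Γ̃ ++ [ β , S ])) ⇝ᶜ_) ys →
  ∃[ Xs ] ∃[ Ws ] ∃[ Ys ] ∃[ Zs ]
    (All ((α , node Δ̃ Γ̃) ⇝ᶜ_) Xs × All ((β , S) ⇝ᶜ_) Ws ×
     (NonEmpty ys → NonEmpty Xs × NonEmpty Ws) ×
     Xs ++ Ws ↭ Ys × (∀ {Δ} rest → Star (OnChildren (Rewrite J) Δ) (Ys ++ rest) (Zs ++ rest)) ×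
     Pointwise _≃ᶜ_ Zs ys)
J-commutes-each β<α [] = [] , [] , [] , [] , [] , [] , (λ ()) , ↭-refl , (λ _ → ε) , []
J-commutes-each {β = β} {α} {S} {Δ̃ = Δ̃} β<α (d ∷ ds) with J-split d | J-commutes-each β<α ds
... | us , ws , dₓ , ne , dws , e | Xs , Ws , Ys , Zs , dXs , dWs , _ , p , steps , es =
  (α , node Δ̃ us) ∷ Xs , ws ++ Ws , (α , node Δ̃ us) ∷ ws ++ Ys , (α , node Δ̃ (us ++ ws)) ∷ Zs ,
  dₓ ∷ dXs , All-++⁺ dws dWs , (λ _ → nonEmpty , NonEmpty-++ ne) ,
  ↭-prep _ (trans (shifts Xs ws) (++⁺ˡ ws p)) ,
  (λ rest → subst (λ L → Star _ ((α , node Δ̃ us) ∷ L) ((α , node Δ̃ (us ++ ws)) ∷ Ys ++ rest))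
                    (≡.sym (++-assoc ws Ys rest))
              (J-merge⋆ us ws (Ys ++ rest) (All.map (λ { (child _) → β<α }) dws))
            ◅◅ Rewrite-∷⋆ (λ ()) (steps rest)) ,
  e ∷ es

J-commutes : ∀ {Δ̃ Γ̃} → β < α →
             BlockCommutes ((α , node Δ̃ Γ̃) ∷ [ β , S ]) (α , node Δ̃ (Γ̃ ++ [ β , S ]))
J-commutes β<α ne ds with J-commutes-each β<α ds
... | Xs , Ws , Ys , Zs , dXs , dWs , ne⇒ , p , steps , es with ne⇒ ne
... | neX , neW =
  Xs ++ Ws , Ys , Zs , Blocks-++ (Blocks-singleton neX dXs) (Blocks-singleton neW dWs) , p ,
  (λ rest → gmap id (λ s → J , J-modal , s) (steps rest)) , refl es

Rewrite-modal-commutes : IsModal μ → Rewrite μ T U → U ⇝ X → ExpandThenModal T X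
Rewrite-modal-commutes m (inside {Γ} {i} l s) =
  root-commutes (‼-↭-∷del Γ i l) (upd-↭-∷del Γ i l) (inside-commutes (Rewrite-modal-commutes m s))
Rewrite-modal-commutes lam-modal (root (lam-loc {Γ = Γ} i α β S l β<α)) =
  root-commutes (‼-↭-∷del Γ i l) (upd-↭-∷del Γ i l) (lam-commutes β<α)
Rewrite-modal-commutes J-modal (root (J-loc {Γ = Γ} i j α β Δ̃ Γ̃ S i≢j lᵢ lⱼ β<α))
  with ↭-∷∷del Γ i j lᵢ lⱼ i≢j
... | _ , pΓ , f = root-commutes pΓ (f _) (J-commutes β<α)

Modal⋆-commutes : Star Modal T U → U ⇝ X → ExpandThenModal T X
Modal⋆-commutes ε d = _ , _ , d , ε , ≃-refl _
Modal⋆-commutes ((μ , m , s) ◅ ss) d with Modal⋆-commutes ss d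
... | Y₀ , Z₀ , d₀ , ss₀ , e₀ with Rewrite-modal-commutes m s d₀
... | Y , Z , d′ , ss′ , e with Star-≃-simulates Modal-≃-simulates (≃-sym e) ss₀
... | Z′ , ss″ , e′ = Y , Z′ , d′ , ss′ ◅◅ ss″ , ≃-trans (≃-sym e′) e₀

Rewrite⋆⇒Step⋆ : Star (Rewrite μ) T U → Star* μ T U
Rewrite⋆⇒Step⋆ = gmap id Rewrite⇒Step

Step⋆⇒Rewrite⋆ : Star* μ T U → Star (Rewrite μ) T U
Step⋆⇒Rewrite⋆ = gmap id Step⇒Rewrite

Steps⇒Modal⋆ : ∀ {Ω} → All IsModal Ω → Steps Ω T U → Star Modal T U
Steps⇒Modal⋆ []       done        = ε
Steps⇒Modal⋆ (m ∷ ms) (step s ss) = (_ , m , Step⇒Rewrite s) ◅ Steps⇒Modal⋆ ms ss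

Modal⋆⇒Steps : Star Modal T U → ∃[ Ω ] (All IsModal Ω × Steps Ω T U)
Modal⋆⇒Steps ε                  = [] , [] , done
Modal⋆⇒Steps ((μ , m , s) ◅ ss) with Modal⋆⇒Steps ss
... | Ω , ms , steps = μ ∷ Ω , m ∷ ms , step (Rewrite⇒Step s) steps

lam-π⁺-postpone : ∀ n → Rewrite lam T U → Steps (replicate n π⁺) U V →
                ∃[ U′ ] (Steps (replicate n π⁺) T U′ × Star (Rewrite lam) U′ V)
lam-π⁺-postpone n s ss with ≥ˡ-π⁺-steps n (lam⇒≥ˡ s) ss
... | U′ , ss′ , r = U′ , ss′ , ≥ˡ⇒lam⋆ r

modal-π⁺-postpone : Star Modal T U → Star (Rewrite π⁺) U V →
  ∃[ Y ] ∃[ Z ] (Star (Rewrite π⁺) T Y × Star Modal Y Z × Star (Rewrite σ) Z V)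
modal-π⁺-postpone ms ps with Modal⋆-commutes ms (⇝-π⁺⋆ (⇝-refl _) ps)
... | _ , _ , d , ms′ , e with ⇝⇒⟶⋆≃ d
... | Y , ps′ , e′ with Star-≃-simulates Modal-≃-simulates (≃-sym e′) ms′
... | Z , ms″ , e″ = Y , Z , ps′ , ms″ , ≃⇒σ⋆ (≃-trans (≃-sym e″) e)

mainTheorem19 :
    (∀ (n : ℕ) (T S : Tree) →
      (∃[ U ] (Step lam T U × Steps (replicate n π⁺) U S)) →
      ∃[ U ] (Steps (replicate n π⁺) T U × Star* lam U S))
    ×
    (∀ (Ω : List Rule) → All IsModal Ω → ∀ (T S : Tree) →
      (∃[ U ] (Steps Ω T U × Star* π⁺ U S)) →
      ∃[ Ω′ ] (All IsModal Ω′ × ∃[ U ] ∃[ V ]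
        (Star* π⁺ T U × Steps Ω′ U V × Star* σ V S)))
mainTheorem19 =
  (λ n T S (U , s , ss) →
    let U′ , ss′ , ls = lam-π⁺-postpone n (Step⇒Rewrite s) ss
    in U′ , ss′ , Rewrite⋆⇒Step⋆ ls) ,
  (λ Ω modal T S (U , steps , ps) →
    let Y , Z , ps′ , ms , σs = modal-π⁺-postpone (Steps⇒Modal⋆ modal steps) (Step⋆⇒Rewrite⋆ ps)
        Ω′ , modal′ , steps′ = Modal⋆⇒Steps ms
    in Ω′ , modal′ , Y , Z , Rewrite⋆⇒Step⋆ ps′ , steps′ , Rewrite⋆⇒Step⋆ σs)
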